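{- Let $\mathcal H$ be a linear hybrid automaton with $|\mathrm{Loc}|$ locations and $|\mathrm{Edges}|$ edges. For any timed path $\pi$ of $\mathcal H$ (and any choices made in the contraction steps), $|\mathrm{Cnt}^*(\pi)|\le |\mathrm{Loc}|\cdot\big(2^{|\mathrm{Edges}|+1}+1\big)$.
   Context: A linear hybrid automaton has a finite set $\mathrm{Loc}$ of locations and a finite set $\mathrm{Edges}$ of edges; each edge $e$ has a source location $\mathrm{src}(e)$ and target location $\mathrm{trg}(e)$ (other components are irrelevant here). A path is a finite sequence of edges $e_1,\dots,e_n$ with $\mathrm{trg}(e_i)=\mathrm{src}(e_{i+1})$; it is a cycle if moreover $\mathrm{trg}(e_n)=\mathrm{src}(e_1)$, and a simple cycle if it is a cycle with $\mathrm{src}(e_i)\ne\mathrm{src}(e_j)$ for $i\ne j$. A timed path is a sequence $\pi=(t_1,e_1),\dots,(t_n,e_n)$ with $e_1,\dots,e_n$ a path and $t_i\in\mathbb R_{\ge0}$; its length $|\pi|$ is $n$; $\pi[i:j]$ denotes $(t_i,e_i),\dots,(t_j,e_j)$ (empty if $j<i$). Contraction step: if there exist $1\le j\le k<j'\le k'\le n$ such that $e_j\dots e_k$ and $e_{j'}\dots e_{k'}$ are the same sequence of edges and this sequence is a simple cycle, then (for one such choice) $\mathrm{Cnt}(\pi)=\pi[1:j-1]\cdot(t_j+t_{j'},e_j)\cdots(t_k+t_{k'},e_k)\cdot\pi[k+1:j'-1]\cdot\pi[k'+1:n]$; otherwise $\mathrm{Cnt}(\pi)=\pi$. Let $\mathrm{Cnt}^0(\pi)=\pi$,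 $\mathrm{Cnt}^i(\pi)=\mathrm{Cnt}(\mathrm{Cnt}^{i-1}(\pi))$, and $\mathrm{Cnt}^*(\pi)=\mathrm{Cnt}^m(\pi)$ for the least $m$ with $\mathrm{Cnt}^m(\pi)=\mathrm{Cnt}^{m+1}(\pi)$. -}

module Defs where

open import Data.Nat using (ℕ)
open import Data.Fin using (Fin)
open import Data.List using (List; []; _∷_; _++_; [_]; map; zipWith; length)
open import Data.List.Relation.Unary.Linked using (Linked)
open import Data.List.Relation.Unary.Unique.Propositional using (Unique)
open import Data.Product using (Σ; _×_; _,_; proj₂; ∃-syntax)
open import Relation.Binary.PropositionalEquality using (_≡_)
open import Relation.Nullary using (¬_)

-- A linear hybrid automaton, keeping only the components relevant here:
-- finitely many locations (Fin nLoc), finitely many edges (Fin nEdge),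
-- with source and target maps.
record LHA : Set where
  field
    nLoc  : ℕ
    nEdge : ℕ
    src   : Fin nEdge → Fin nLoc
    trg   : Fin nEdge → Fin nLoc

module _ (H : LHA) where
  open LHA H

  Edge : Set
  Edge = Fin nEdge

  Consec : Edge → Edge → Set
  Consec e e' = trg e ≡ src e'

  IsPath : List Edge → Set
  IsPath es = Linked Consec es

  -- a cycle: a (nonempty) path e₁…eₙ with trg(eₙ) = src(e₁),
  -- i.e. e₁ … eₙ e₁ is a path
  IsCycle : List Edge → Set
  IsCycle es = Σ Edge λ e → Σ (List Edge) λ es' →
               (es ≡ e ∷ es') × IsPath (e ∷ es' ++ [ e ])

  IsSimpleCycle : List Edge → Set
  IsSimpleCycle es = IsCycle es × Unique (map src es)

  -- timed paths, with time values in an arbitrary carrier T with addition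
  TimedSeq : Set → Set
  TimedSeq T = List (T × Edge)

  edges : {T : Set} → TimedSeq T → List Edge
  edges π = map proj₂ π

  IsTimedPath : {T : Set} → TimedSeq T → Set
  IsTimedPath π = IsPath (edges π)

  addTimes : {T : Set} → (T → T → T) → T × Edge → T × Edge → T × Edge
  addTimes _⊕_ (t , e) (t' , _) = (t ⊕ t' , e)

  -- One contraction step (any admissible choice):
  --   π = A · C₁ · B · C₂ · D  with edges(C₁) = edges(C₂) a simple cycle
  --   (C₁ nonempty as a cycle, i.e. j ≤ k < j' ≤ k'), giving
  --   A · (C₁ ⊕ C₂) · B · D.
  CntStep : {T : Set} → (T → T → T) → TimedSeq T → TimedSeq T → Set
  CntStep {T} _⊕_ π π' =
    ∃[ A ] ∃[ C₁ ] ∃[ B ] ∃[ C₂ ] ∃[ D ]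
      (π ≡ A ++ C₁ ++ B ++ C₂ ++ D)
      × (edges C₁ ≡ edges C₂)
      × IsSimpleCycle (edges C₁)
      × (π' ≡ A ++ zipWith (addTimes _⊕_) C₁ C₂ ++ B ++ D)

  -- no contraction step applies (so Cnt(π) = π)
  Irreducible : {T : Set} → (T → T → T) → TimedSeq T → Set
  Irreducible _⊕_ π = ∀ π' → ¬ CntStep _⊕_ π π'

module Submission where

-- Contracting a repeated simple cycle keeps a timed path a path: the second copy of the
-- cycle is a closed walk, so cutting it out leaves a connected walk. An irreducible path
-- therefore contains no simple cycle twice. Cutting such a path greedily right after the
-- first repeated source location splits it into blocks of at most |Loc| edges, each block
-- but the last ending in a simple cycle, and these cycles are pairwise distinct; so its
-- length is at most |Loc| · (1 + number of simple cycles). A simple cycle through a location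
-- v is a rotation X ++ e ∷ Y of a cycle e ∷ Y ++ X with e leaving v and Y ++ X a simple path
-- back to v; summing 1 + |P| over the simple paths P gives at most 2^|A| for an edge set A
-- (induction on the out-degree d of the current location, using 2d ≤ 2^d). Hence there are
-- at most 2^|Edges| simple cycles, and the length is at most |Loc| · (2^|Edges| + 1).

open import Defs

open import Data.Empty using (⊥-elim)
open import Data.Fin using (Fin; _≟_)
open import Data.List using (List; []; _∷_; _++_; [_]; map; length; concatMap; filter; zipWith; allFin)
open import Data.List.Properties
  using (length-++; length-map; length-tabulate; map-++; ∷-injective; ++-identityʳ; ++-assoc)
open import Data.List.Membership.Propositional using (_∈_; find; lose)
open import Data.List.Membership.Propositional.Properties
  using (∈-concatMap⁺; ∈-filter⁺; ∈-map⁺; ∈-map⁻; ∈-allFin; ∈-++⁺ˡ; ∈-++⁺ʳ; ∈-++⁻; ∈-∃++)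
open import Data.List.Relation.Binary.Permutation.Propositional using (↭-sym; ↭⇒↭ₛ)
import Data.List.Relation.Binary.Permutation.Propositional.Properties as ↭
open ↭ using (++-comm; ↭-length; shift; ∈-resp-↭)
import Data.List.Relation.Binary.Permutation.Setoid.Properties as PermutationSetoid
open import Data.List.Relation.Binary.Subset.Propositional using (_⊆_)
open import Data.List.Relation.Unary.All as All using (All; []; _∷_)
open import Data.List.Relation.Unary.Any as Any using (here; there; any?)
open import Data.List.Relation.Unary.Linked using ([]; [-]; _∷_)
open import Data.List.Relation.Unary.Unique.Propositional using (Unique; []; _∷_)
open import Data.List.Relation.Unary.Unique.Propositional.Properties
  using (Unique[x∷xs]⇒x∉xs) renaming (++⁺ to Unique-++⁺)
open import Data.Nat using (ℕ; zero; suc; _+_; _*_; _^_; _≤_; _<_; z≤n; s≤s; z<s)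
open import Data.Nat.Induction using (<-wellFounded)
open import Data.Nat.Properties
  using (≤-reflexive; ≤-trans; +-assoc; +-comm; +-identityʳ; +-suc; *-assoc; *-comm; *-identityʳ;
         *-suc; *-distribˡ-+; +-mono-≤; *-monoˡ-≤; *-monoʳ-≤; ^-monoʳ-≤; ^-distribˡ-+-*; m^n>0;
         m≤m+n; m≤n+m; m<m+n; m<n⇒m<1+n; module ≤-Reasoning)
open import Data.Product using (∃; ∃₂; _×_; _,_; map₁; proj₂)
open import Data.Sum using (inj₁; inj₂)
open import Function using (_∘_; id)
open import Induction.WellFounded using (Acc; acc)
open import Relation.Binary.Construct.Closure.ReflexiveTransitive using (Star; ε; _◅_)
open import Relation.Binary.Definitions using (DecidableEquality)
open import Relation.Binary.PropositionalEquality hiding ([_])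
open import Relation.Nullary using (¬_; yes; no)
open import Relation.Unary using (Pred; Decidable)
open import Relation.Unary.Properties using (∁?)

module _ {A : Set} where

  Unique-map-++-comm : ∀ {B : Set} (f : A → B) xs ys →
                       Unique (map f (xs ++ ys)) → Unique (map f (ys ++ xs))
  Unique-map-++-comm {B} f xs ys =
    PermutationSetoid.Unique-resp-↭ (setoid B) (↭⇒↭ₛ (↭.map⁺ f (++-comm xs ys)))

  Unique-++⁻ʳ : ∀ xs {ys : List A} → Unique (xs ++ ys) → Unique ys
  Unique-++⁻ʳ []       u       = u
  Unique-++⁻ʳ (_ ∷ xs) (_ ∷ u) = Unique-++⁻ʳ xs u

  Unique-⊆⇒length≤ : ∀ {xs ys : List A} → Unique xs → xs ⊆ ys → length xs ≤ length ys
  Unique-⊆⇒length≤ {[]}     _           _     = z≤n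
  Unique-⊆⇒length≤ {x ∷ xs} (x∉xs ∷ u) xs⊆ys
    with ys₁ , ys₂ , refl ← ∈-∃++ (xs⊆ys (here refl)) = begin
      suc (length xs)                ≤⟨ s≤s (Unique-⊆⇒length≤ u xs⊆ys₁++ys₂) ⟩
      suc (length (ys₁ ++ ys₂))      ≡⟨ ↭-length (shift x ys₁ ys₂) ⟨
      length (ys₁ ++ x ∷ ys₂)        ∎
    where
    open ≤-Reasoning
    xs⊆ys₁++ys₂ : xs ⊆ ys₁ ++ ys₂
    xs⊆ys₁++ys₂ z∈xs with ∈-++⁻ ys₁ (xs⊆ys (there z∈xs))
    ... | inj₁ z∈ys₁         = ∈-++⁺ˡ z∈ys₁
    ... | inj₂ (here refl)   = ⊥-elim (All.lookup x∉xs z∈xs refl)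
    ... | inj₂ (there z∈ys₂) = ∈-++⁺ʳ ys₁ z∈ys₂

  length-<-++-∷ : ∀ p {x : A} q ys → length ys < length ((p ++ x ∷ q) ++ ys)
  length-<-++-∷ []      q ys =
    s≤s (subst (length ys ≤_) (sym (length-++ q)) (m≤n+m (length ys) (length q)))
  length-<-++-∷ (_ ∷ p) q ys = m<n⇒m<1+n (length-<-++-∷ p q ys)

  length-filter+length-filter-∁ : ∀ {p} {P : Pred A p} (P? : Decidable P) xs →
    length (filter P? xs) + length (filter (∁? P?) xs) ≡ length xs
  length-filter+length-filter-∁ P? []       = refl
  length-filter+length-filter-∁ P? (x ∷ xs) with P? x
  ... | yes _ = cong suc (length-filter+length-filter-∁ P? xs)
  ... | no  _ = trans (+-suc _ _) (cong suc (length-filter+length-filter-∁ P? xs))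

  map-++⁻ : ∀ {B : Set} (f : A → B) xs {ys zs} → map f xs ≡ ys ++ zs →
            ∃₂ λ xs₁ xs₂ → xs ≡ xs₁ ++ xs₂ × map f xs₁ ≡ ys × map f xs₂ ≡ zs
  map-++⁻ f xs       {[]}     eq = [] , xs , refl , refl , eq
  map-++⁻ f (x ∷ xs) {y ∷ ys} eq
    with refl , eq′ ← ∷-injective eq
    with xs₁ , xs₂ , refl , refl , refl ← map-++⁻ f xs {ys} eq′
    = x ∷ xs₁ , xs₂ , refl , refl , refl

  splittings : List A → List (List A × List A)
  splittings []       = [ ([] , []) ]
  splittings (x ∷ xs) = ([] , x ∷ xs) ∷ map (map₁ (x ∷_)) (splittings xs)

  ∈-splittings : ∀ ys zs → (ys , zs) ∈ splittings (ys ++ zs)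
  ∈-splittings []       []       = here refl
  ∈-splittings []       (_ ∷ _)  = here refl
  ∈-splittings (y ∷ ys) zs       = there (∈-map⁺ (map₁ (y ∷_)) (∈-splittings ys zs))

  rotations : A → List A → List (List A)
  rotations x xs = map (λ (ys , zs) → zs ++ x ∷ ys) (splittings xs)

  ∈-rotations : ∀ x ys zs → zs ++ x ∷ ys ∈ rotations x (ys ++ zs)
  ∈-rotations x ys zs = ∈-map⁺ (λ (ys , zs) → zs ++ x ∷ ys) (∈-splittings ys zs)

  length-rotations : ∀ x xs → length (rotations x xs) ≡ suc (length xs)
  length-rotations x xs = trans (length-map _ (splittings xs)) (length-splittings xs)
    where
    length-splittings : ∀ xs → length (splittings xs) ≡ suc (length xs)
    length-splittings []       = refl
    length-splittings (x ∷ xs) = cong suc (trans (length-map _ (splittings xs)) (length-splittings xs))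

  rotationCount : List (List A) → ℕ
  rotationCount []         = 0
  rotationCount (xs ∷ xss) = suc (length xs) + rotationCount xss

  length-concatMap-rotations : ∀ x xss → length (concatMap (rotations x) xss) ≡ rotationCount xss
  length-concatMap-rotations x []         = refl
  length-concatMap-rotations x (xs ∷ xss) = begin
    length (rotations x xs ++ concatMap (rotations x) xss)
      ≡⟨ length-++ (rotations x xs) ⟩
    length (rotations x xs) + length (concatMap (rotations x) xss)
      ≡⟨ cong₂ _+_ (length-rotations x xs) (length-concatMap-rotations x xss) ⟩
    suc (length xs) + rotationCount xss ∎
    where open ≡-Reasoning

  rotationCount-++ : ∀ xss yss → rotationCount (xss ++ yss) ≡ rotationCount xss + rotationCount yss
  rotationCount-++ []         yss = refl
  rotationCount-++ (xs ∷ xss) yss = trans (cong (suc (length xs) +_) (rotationCount-++ xss yss))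
                                          (sym (+-assoc (suc (length xs)) _ _))

  rotationCount-map-∷ : ∀ x xss → rotationCount (map (x ∷_) xss) ≤ 2 * rotationCount xss
  rotationCount-map-∷ x []         = z≤n
  rotationCount-map-∷ x (xs ∷ xss) = begin
    suc (suc (length xs)) + rotationCount (map (x ∷_) xss)
      ≤⟨ +-mono-≤ (m<m+n (suc (length xs)) z<s) (rotationCount-map-∷ x xss) ⟩
    2 * suc (length xs) + 2 * rotationCount xss
      ≡⟨ *-distribˡ-+ 2 (suc (length xs)) (rotationCount xss) ⟨
    2 * rotationCount (xs ∷ xss) ∎
    where open ≤-Reasoning

  rotationCount-concatMap-≤ : ∀ {B : Set} (f : B → List (List A)) k ys →
    (∀ y → rotationCount (f y) ≤ k) → rotationCount (concatMap f ys) ≤ length ys * k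
  rotationCount-concatMap-≤ f k []       _       = z≤n
  rotationCount-concatMap-≤ f k (y ∷ ys) f-bound = begin
    rotationCount (f y ++ concatMap f ys)                ≡⟨ rotationCount-++ (f y) _ ⟩
    rotationCount (f y) + rotationCount (concatMap f ys)
      ≤⟨ +-mono-≤ (f-bound y) (rotationCount-concatMap-≤ f k ys f-bound) ⟩
    k + length ys * k                                    ∎
    where open ≤-Reasoning

length-concatMap-≤ : ∀ {A B : Set} (f : A → List B) k xs →
  (∀ x → length (f x) ≤ k) → length (concatMap f xs) ≤ length xs * k
length-concatMap-≤ f k []       _       = z≤n
length-concatMap-≤ f k (x ∷ xs) f-bound = begin
  length (f x ++ concatMap f xs)        ≡⟨ length-++ (f x) ⟩
  length (f x) + length (concatMap f xs)
    ≤⟨ +-mono-≤ (f-bound x) (length-concatMap-≤ f k xs f-bound) ⟩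
  k + length xs * k                     ∎
  where open ≤-Reasoning


module _ {A B : Set} (f : A → B) (_≟_ : DecidableEquality B) where

  data UniqueOrRepeat (xs : List A) : Set where
    unique : Unique (map f xs) → UniqueOrRepeat xs
    repeat : ∀ p x q y r → xs ≡ (p ++ x ∷ q) ++ y ∷ r → f x ≡ f y →
             Unique (map f (p ++ x ∷ q)) → UniqueOrRepeat xs

  uniqueOrFirstRepeat : ∀ xs → UniqueOrRepeat xs
  uniqueOrFirstRepeat xs = scan [] xs []
    where
    scan : ∀ seen xs → Unique (map f seen) → UniqueOrRepeat (seen ++ xs)
    scan seen []       u = unique (subst (Unique ∘ map f) (sym (++-identityʳ seen)) u)
    scan seen (y ∷ ys) u with any? (λ x → f x ≟ f y) seen
    ... | yes fy∈seen
      with x , x∈seen , fx≡fy ← find fy∈seen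
      with p , q , refl ← ∈-∃++ x∈seen = repeat p x q y ys refl fx≡fy u
    ... | no fy∉seen = subst UniqueOrRepeat (++-assoc seen [ y ] ys) (scan (seen ++ [ y ]) ys u′)
      where
      u′ : Unique (map f (seen ++ [ y ]))
      u′ = subst Unique (sym (map-++ f seen [ y ])) (Unique-++⁺ u ([] ∷ []) λ where
             (fy∈ , here refl) → let x , x∈seen , fy≡fx = ∈-map⁻ f fy∈
                                 in fy∉seen (lose x∈seen (sym fy≡fx)))

n<2^n : ∀ n → n < 2 ^ n
n<2^n zero    = s≤s z≤n
n<2^n (suc n) = begin
  1 + suc n        ≤⟨ +-mono-≤ (≤-trans (s≤s z≤n) (n<2^n n)) (n<2^n n) ⟩
  2 ^ n + 2 ^ n    ≡⟨ cong (2 ^ n +_) (+-identityʳ (2 ^ n)) ⟨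
  2 ^ suc n        ∎
  where open ≤-Reasoning

2*n≤2^n : ∀ n → 2 * n ≤ 2 ^ n
2*n≤2^n zero    = z≤n
2*n≤2^n (suc n) = *-monoʳ-≤ 2 (n<2^n n)

module Graph (H : LHA) where
  open LHA H

  Loc : Set
  Loc = Fin nLoc

  infixr 5 _∷_ _++ᵂ_

  data Walk : Loc → List (Edge H) → Loc → Set where
    []  : ∀ {v} → Walk v [] v
    _∷_ : ∀ {v e es w} → src e ≡ v → Walk (trg e) es w → Walk v (e ∷ es) w

  private variable
    u v w : Loc
    e : Edge H
    es xs ys : List (Edge H)

  _++ᵂ_ : Walk u xs v → Walk v ys w → Walk u (xs ++ ys) w
  []         ++ᵂ q = q
  (src≡ ∷ p) ++ᵂ q = src≡ ∷ (p ++ᵂ q)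

  splitWalk : ∀ xs → Walk u (xs ++ ys) w → ∃ λ v → Walk u xs v × Walk v ys w
  splitWalk []       p = _ , [] , p
  splitWalk (x ∷ xs) (src≡ ∷ p) with v , p₁ , p₂ ← splitWalk xs p = v , src≡ ∷ p₁ , p₂

  walk-start : Walk u (e ∷ es) w → src e ≡ u
  walk-start (src≡ ∷ _) = src≡

  walk-end-unique : ∀ {w′} → Walk u es w → Walk u es w′ → w ≡ w′
  walk-end-unique []      []      = refl
  walk-end-unique (_ ∷ p) (_ ∷ q) = walk-end-unique p q

  walk⇒path : Walk u es w → IsPath H es
  walk⇒path []             = []
  walk⇒path (_ ∷ [])       = [-]
  walk⇒path (_ ∷ src≡ ∷ p) = sym src≡ ∷ walk⇒path (src≡ ∷ p)

  nonempty-path⇒walk : IsPath H (e ∷ es) → ∃ (Walk (src e) (e ∷ es))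
  nonempty-path⇒walk [-]           = _ , refl ∷ []
  nonempty-path⇒walk (trg≡src ∷ path)
    with w , walk ← nonempty-path⇒walk path
    = w , refl ∷ subst (λ v → Walk v _ w) (sym trg≡src) walk

  -- The location is only used as the endpoints of the empty path.
  path⇒walk : Loc → IsPath H es → ∃₂ λ u w → Walk u es w
  path⇒walk {[]}    v _    = v , v , []
  path⇒walk {e ∷ _} _ path = src e , nonempty-path⇒walk path

  cycle⇒closedWalk : IsCycle H es → ∃ λ v → Walk v es v
  cycle⇒closedWalk (e , es , refl , path)
    with _ , walk ← nonempty-path⇒walk path
    with _ , walk₁ , walk₂ ← splitWalk (e ∷ es) walk
    = src e , subst (Walk (src e) (e ∷ es)) (sym (walk-start walk₂)) walk₁

  closedWalk⇒cycle : Walk v (e ∷ es) v → IsCycle H (e ∷ es)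
  closedWalk⇒cycle walk = _ , _ , refl , walk⇒path (walk ++ᵂ (walk-start walk ∷ []))

  cycle-walk-closed : IsCycle H es → Walk u es w → u ≡ w
  cycle-walk-closed cycle@(_ , _ , refl , _) walk
    with _ , closed ← cycle⇒closedWalk cycle
    with refl ← trans (sym (walk-start walk)) (walk-start closed)
    = walk-end-unique closed walk

  contract-path : ∀ a c b d → IsCycle H c →
                  IsPath H (a ++ c ++ b ++ c ++ d) → IsPath H (a ++ c ++ b ++ d)
  contract-path a c b d cycle@(e , _ , refl , _) path
    with _ , _ , walk       ← path⇒walk (src e) path
    with _ , walkA , walk₁  ← splitWalk a walk
    with _ , walkC , walk₂  ← splitWalk c walk₁
    with _ , walkB , walk₃  ← splitWalk b walk₂
    with _ , walkC′ , walkD ← splitWalk c walk₃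
    with refl ← cycle-walk-closed cycle walkC′
    = walk⇒path (walkA ++ᵂ walkC ++ᵂ walkB ++ᵂ walkD)

  NoRepeatedSimpleCycle : List (Edge H) → Set
  NoRepeatedSimpleCycle es = ∀ a c b d → es ≡ a ++ c ++ b ++ c ++ d → ¬ IsSimpleCycle H c

  NoRepeatedSimpleCycle-++⁻ʳ : ∀ s → NoRepeatedSimpleCycle (s ++ es) → NoRepeatedSimpleCycle es
  NoRepeatedSimpleCycle-++⁻ʳ s noRepeat a c b d refl = noRepeat (s ++ a) c b d (sym (++-assoc s a _))

  module _ {T : Set} (_⊕_ : T → T → T) where

    private variable
      π π′ ρ : TimedSeq H T

    edges-++ : ∀ (π π′ : TimedSeq H T) → edges H (π ++ π′) ≡ edges H π ++ edges H π′
    edges-++ = map-++ proj₂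

    edges-++₄ : ∀ (A C B D : TimedSeq H T) →
                edges H (A ++ C ++ B ++ D) ≡ edges H A ++ edges H C ++ edges H B ++ edges H D
    edges-++₄ A C B D =
      trans (edges-++ A _) (cong (edges H A ++_) (trans (edges-++ C _) (cong (edges H C ++_) (edges-++ B D))))

    edges-zipWith-addTimes : ∀ (π π′ : TimedSeq H T) → length π ≤ length π′ →
                             edges H (zipWith (addTimes H _⊕_) π π′) ≡ edges H π
    edges-zipWith-addTimes []      _        _          = refl
    edges-zipWith-addTimes (x ∷ π) (_ ∷ π′) (s≤s |π|≤|π′|) =
      cong (proj₂ x ∷_) (edges-zipWith-addTimes π π′ |π|≤|π′|)

    contraction-preserves-path : CntStep H _⊕_ π π′ → IsTimedPath H π → IsTimedPath H π′
    contraction-preserves-path (A , C₁ , B , C₂ , D , refl , sameEdges , (cycle , _) , refl) path =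
      subst (IsPath H) (sym after)
        (contract-path (E A) (E C₁) (E B) (E D) cycle (subst (IsPath H) before path))
      where
      E : TimedSeq H T → List (Edge H)
      E = edges H
      before : E (A ++ C₁ ++ B ++ C₂ ++ D) ≡ E A ++ E C₁ ++ E B ++ E C₁ ++ E D
      before = trans (edges-++₄ A C₁ B (C₂ ++ D)) (cong (λ l → E A ++ E C₁ ++ E B ++ l)
                     (trans (edges-++ C₂ D) (cong (_++ E D) (sym sameEdges))))
      |C₁|≤|C₂| : length C₁ ≤ length C₂
      |C₁|≤|C₂| = ≤-reflexive
        (trans (sym (length-map proj₂ C₁)) (trans (cong length sameEdges) (length-map proj₂ C₂)))
      after : E (A ++ zipWith (addTimes H _⊕_) C₁ C₂ ++ B ++ D) ≡ E A ++ E C₁ ++ E B ++ E D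
      after = trans (edges-++₄ A (zipWith (addTimes H _⊕_) C₁ C₂) B D)
                    (cong (λ l → E A ++ l ++ E B ++ E D) (edges-zipWith-addTimes C₁ C₂ |C₁|≤|C₂|))

    contractions-preserve-path : Star (CntStep H _⊕_) π ρ → IsTimedPath H π → IsTimedPath H ρ
    contractions-preserve-path ε              path = path
    contractions-preserve-path (step ◅ steps) path =
      contractions-preserve-path steps (contraction-preserves-path step path)


    irreducible⇒noRepeatedSimpleCycle : Irreducible H _⊕_ ρ → NoRepeatedSimpleCycle (edges H ρ)
    irreducible⇒noRepeatedSimpleCycle {ρ} irreducible a c b d eq simple
      with A  , ρ₁ , refl , refl , eq₁        ← map-++⁻ proj₂ ρ {a} eq
      with C₁ , ρ₂ , refl , refl , eq₂        ← map-++⁻ proj₂ ρ₁ {c} eq₁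
      with B  , ρ₃ , refl , refl , eq₃        ← map-++⁻ proj₂ ρ₂ {b} eq₂
      with C₂ , D  , refl , sameEdges , refl ← map-++⁻ proj₂ ρ₃ {map proj₂ C₁} eq₃
      = irreducible _ (A , C₁ , B , C₂ , D , refl , sym sameEdges , simple , refl)

  Unique⇒length≤nLoc : {vs : List Loc} → Unique vs → length vs ≤ nLoc
  Unique⇒length≤nLoc {vs} u =
    subst (length vs ≤_) (length-tabulate id) (Unique-⊆⇒length≤ u (λ {v} _ → ∈-allFin v))

  distinctSources⇒length≤nLoc : Unique (map src es) → length es ≤ nLoc
  distinctSources⇒length≤nLoc {es} u = subst (_≤ nLoc) (length-map src es) (Unique⇒length≤nLoc u)

  _OccursIn_ : List (Edge H) → List (Edge H) → Set
  c OccursIn es = ∃₂ λ x y → es ≡ x ++ c ++ y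

  OccursIn-++ : ∀ {c} s → c OccursIn es → c OccursIn (s ++ es)
  OccursIn-++ s (x , y , refl) = s ++ x , y , sym (++-assoc s x _)

  CycleBlocks : List (Edge H) → Set
  CycleBlocks es = ∃ λ Cs → Unique Cs × All (IsSimpleCycle H) Cs × All (_OccursIn es) Cs ×
                            length es ≤ nLoc * suc (length Cs)

  cycleBlocks : ∀ es → Acc _<_ (length es) → Walk u es w → NoRepeatedSimpleCycle es → CycleBlocks es
  cycleBlocks es (acc shorter) walk noRepeat with uniqueOrFirstRepeat src _≟_ es
  ... | unique u =
    [] , [] , [] , [] , subst (length es ≤_) (sym (*-identityʳ nLoc)) (distinctSources⇒length≤nLoc u)
  ... | repeat p x q y r refl srcx≡srcy u
    with _ , walk₁ , walk₂ ← splitWalk (p ++ x ∷ q) walk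
    with _ , _ , walkC     ← splitWalk p walk₁
    = addBlock (cycleBlocks (y ∷ r) (shorter (length-<-++-∷ p q (y ∷ r))) walk₂
                  (NoRepeatedSimpleCycle-++⁻ʳ (p ++ x ∷ q) noRepeat))
    where
    c = x ∷ q
    simple : IsSimpleCycle H c
    simple = closedWalk⇒cycle (subst₂ (λ a b → Walk a c b) (sym (walk-start walkC))
                                      (sym (trans srcx≡srcy (walk-start walk₂))) walkC)
           , Unique-++⁻ʳ (map src p) (subst Unique (map-++ src p c) u)
    c≢ : ∀ {c′} → c′ OccursIn (y ∷ r) → c ≢ c′
    c≢ (x′ , y′ , eq) refl =
      noRepeat p c x′ y′ (trans (++-assoc p c (y ∷ r)) (cong (λ l → p ++ c ++ l) eq)) simple
    addBlock : CycleBlocks (y ∷ r) → CycleBlocks ((p ++ c) ++ y ∷ r)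
    addBlock (Cs , uniqueCs , simpleCs , occursCs , bound) =
      c ∷ Cs , All.map c≢ occursCs ∷ uniqueCs , simple ∷ simpleCs ,
      (p , y ∷ r , ++-assoc p c (y ∷ r)) ∷ All.map (OccursIn-++ (p ++ c)) occursCs , (begin
        length ((p ++ c) ++ y ∷ r)                ≡⟨ length-++ (p ++ c) ⟩
        length (p ++ c) + length (y ∷ r)          ≤⟨ +-mono-≤ (distinctSources⇒length≤nLoc u) bound ⟩
        nLoc + nLoc * suc (length Cs)             ≡⟨ *-suc nLoc (suc (length Cs)) ⟨
        nLoc * suc (length (c ∷ Cs))              ∎)
      where open ≤-Reasoning

  outsOf othersOf : Loc → List (Edge H) → List (Edge H)
  outsOf   v = filter (λ e → src e ≟ v)
  othersOf v = filter (∁? (λ e → src e ≟ v))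

  2^outsOf*2^othersOf : ∀ v A → 2 ^ length (outsOf v A) * 2 ^ length (othersOf v A) ≡ 2 ^ length A
  2^outsOf*2^othersOf v A = trans (sym (^-distribˡ-+-* 2 (length (outsOf v A)) (length (othersOf v A))))
                                  (cong (2 ^_) (length-filter+length-filter-∁ (λ e → src e ≟ v) A))

  ⊆-othersOf : ∀ {A} → es ⊆ A → (∀ {e} → e ∈ es → src e ≢ v) → es ⊆ othersOf v A
  ⊆-othersOf {v = v} es⊆A avoids-v e∈es =
    ∈-filter⁺ (∁? (λ e → src e ≟ v)) (es⊆A e∈es) (avoids-v e∈es)

  -- Dropping the out-edges of each location left behind keeps the sources pairwise distinct.
  simplePaths : ℕ → List (Edge H) → Loc → Loc → List (List (Edge H))
  simplePaths zero    A w u = []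
  simplePaths (suc n) A w u with w ≟ u
  ... | yes _ = [ [] ]
  ... | no  _ = concatMap (λ f → map (f ∷_) (simplePaths n (othersOf w A) (trg f) u)) (outsOf w A)

  rotationCount-simplePaths : ∀ n A w u → rotationCount (simplePaths n A w u) ≤ 2 ^ length A
  rotationCount-simplePaths zero    A w u = z≤n
  rotationCount-simplePaths (suc n) A w u with w ≟ u
  ... | yes _ = m^n>0 2 (length A)
  ... | no  _ = begin
    rotationCount (concatMap (λ f → map (f ∷_) (simplePaths n R (trg f) u)) O)
      ≤⟨ rotationCount-concatMap-≤ _ (2 * 2 ^ length R) O (λ f →
           ≤-trans (rotationCount-map-∷ f (simplePaths n R (trg f) u))
                   (*-monoʳ-≤ 2 (rotationCount-simplePaths n R (trg f) u))) ⟩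
    length O * (2 * 2 ^ length R)   ≡⟨ *-assoc (length O) 2 _ ⟨
    length O * 2 * 2 ^ length R     ≡⟨ cong (_* 2 ^ length R) (*-comm (length O) 2) ⟩
    2 * length O * 2 ^ length R     ≤⟨ *-monoˡ-≤ (2 ^ length R) (2*n≤2^n (length O)) ⟩
    2 ^ length O * 2 ^ length R     ≡⟨ 2^outsOf*2^othersOf w A ⟩
    2 ^ length A                    ∎
    where
    open ≤-Reasoning
    O = outsOf w A
    R = othersOf w A

  ∈-simplePaths : ∀ n A {P} → Walk w P u → Unique (u ∷ map src P) → P ⊆ A → length P < n →
                  P ∈ simplePaths n A w u
  ∈-simplePaths {w} {u} (suc n) A walk distinct P⊆A |P|<n with w ≟ u
  ∈-simplePaths (suc n) A []          _         _ _ | yes _   = here refl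
  ∈-simplePaths (suc n) A (src≡w ∷ _) (u∉ ∷ _)  _ _ | yes w≡u =
    ⊥-elim (All.head u∉ (sym (trans src≡w w≡u)))
  ∈-simplePaths (suc n) A []          _         _ _ | no  w≢u = ⊥-elim (w≢u refl)
  ∈-simplePaths {w} (suc n) A {f ∷ P} (src≡w ∷ walk) (u∉ ∷ f∉ ∷ distinct) P⊆A (s≤s |P|<n)
    | no _ =
    ∈-concatMap⁺ _ (lose (∈-filter⁺ (λ e → src e ≟ w) (P⊆A (here refl)) src≡w)
      (∈-map⁺ (f ∷_) (∈-simplePaths n _ walk (All.tail u∉ ∷ distinct) P⊆others |P|<n)))
    where
    P⊆others : P ⊆ othersOf w A
    P⊆others = ⊆-othersOf (P⊆A ∘ there)
      (λ e∈P srce≡w → All.lookup f∉ (∈-map⁺ src e∈P) (trans src≡w (sym srce≡w)))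

  rotateClosedWalk : ∀ X {Y} → Walk u (X ++ e ∷ Y) u → Walk (trg e) (Y ++ X) (src e)
  rotateClosedWalk X walk with _ , walkX , src≡ ∷ walkY ← splitWalk X walk =
    walkY ++ᵂ subst (Walk _ X) (sym src≡) walkX

  -- Fuel nLoc suffices: a simple path back to v has fewer than nLoc edges.
  cyclesThrough : Loc → List (Edge H) → List (List (Edge H))
  cyclesThrough v A =
    concatMap (λ e → concatMap (rotations e) (simplePaths nLoc (othersOf v A) (trg e) v)) (outsOf v A)

  length-cyclesThrough : ∀ v A →
    length (cyclesThrough v A) ≤ length (outsOf v A) * 2 ^ length (othersOf v A)
  length-cyclesThrough v A = length-concatMap-≤ _ _ (outsOf v A) λ e →
    ≤-trans (≤-reflexive (length-concatMap-rotations e (simplePaths nLoc R (trg e) v)))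
            (rotationCount-simplePaths nLoc R (trg e) v)
    where R = othersOf v A

  ∈-cyclesThrough : ∀ {A} X {Y} → Walk u (X ++ e ∷ Y) u → Unique (map src (X ++ e ∷ Y)) →
                    X ++ e ∷ Y ⊆ A → src e ≡ v → X ++ e ∷ Y ∈ cyclesThrough v A
  ∈-cyclesThrough {e = e} {v = v} {A = A} X {Y} walk distinct c⊆A refl =
    ∈-concatMap⁺ _ (lose (∈-filter⁺ (λ e → src e ≟ v) (c⊆A (∈-++⁺ʳ X (here refl))) refl)
      (∈-concatMap⁺ (rotations e)
        (lose (∈-simplePaths nLoc _ (rotateClosedWalk X walk) distinct′ P⊆others |P|<nLoc)
              (∈-rotations e Y X))))
    where
    distinct′ : Unique (src e ∷ map src (Y ++ X))
    distinct′ = Unique-map-++-comm src X (e ∷ Y) distinct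
    P⊆others : Y ++ X ⊆ othersOf v A
    P⊆others = ⊆-othersOf (c⊆A ∘ ∈-resp-↭ (↭-sym (shift e X Y)) ∘ there ∘ ∈-resp-↭ (++-comm Y X))
      (λ e′∈P srce′≡v →
        Unique[x∷xs]⇒x∉xs distinct′ (subst (_∈ map src (Y ++ X)) srce′≡v (∈-map⁺ src e′∈P)))
    |P|<nLoc : length (Y ++ X) < nLoc
    |P|<nLoc = subst (λ n → suc n ≤ nLoc) (length-map src (Y ++ X)) (Unique⇒length≤nLoc distinct′)

  simpleCycles : List Loc → List (Edge H) → List (List (Edge H))
  simpleCycles []      A = []
  simpleCycles (v ∷ L) A = simpleCycles L (othersOf v A) ++ cyclesThrough v A

  length-simpleCycles : ∀ L A → length (simpleCycles L A) ≤ 2 ^ length A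
  length-simpleCycles []      A = z≤n
  length-simpleCycles (v ∷ L) A = begin
    length (simpleCycles L R ++ cyclesThrough v A)          ≡⟨ length-++ (simpleCycles L R) ⟩
    length (simpleCycles L R) + length (cyclesThrough v A)
      ≤⟨ +-mono-≤ (length-simpleCycles L R) (length-cyclesThrough v A) ⟩
    suc (length (outsOf v A)) * 2 ^ length R
      ≤⟨ *-monoˡ-≤ (2 ^ length R) (n<2^n (length (outsOf v A))) ⟩
    2 ^ length (outsOf v A) * 2 ^ length R                  ≡⟨ 2^outsOf*2^othersOf v A ⟩
    2 ^ length A                                            ∎
    where
    open ≤-Reasoning
    R = othersOf v A

  ∈-simpleCycles : ∀ L A {c} → Walk u c u → Unique (map src c) → c ⊆ A →
                   (∀ {e} → e ∈ c → src e ∈ L) → c ≢ [] → c ∈ simpleCycles L A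
  ∈-simpleCycles []      A {[]}    _    _        _   _      nonempty = ⊥-elim (nonempty refl)
  ∈-simpleCycles []      A {_ ∷ _} _    _        _   srcs∈L _ with () ← srcs∈L (here refl)
  ∈-simpleCycles (v ∷ L) A {c} walk distinct c⊆A srcs∈L nonempty with any? (λ e → src e ≟ v) c
  ... | yes through-v
    with e , e∈c , src≡v ← find through-v
    with X , Y , refl ← ∈-∃++ e∈c
    = ∈-++⁺ʳ (simpleCycles L _) (∈-cyclesThrough X walk distinct c⊆A src≡v)
  ... | no avoids-v = ∈-++⁺ˡ (∈-simpleCycles L _ walk distinct
          (⊆-othersOf c⊆A (λ e∈c src≡v → avoids-v (lose e∈c src≡v)))
          (λ e∈c → Any.tail (λ src≡v → avoids-v (lose e∈c src≡v)) (srcs∈L e∈c)) nonempty)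

  simpleCycle∈simpleCycles : ∀ {c} → IsSimpleCycle H c →
                             c ∈ simpleCycles (allFin nLoc) (allFin nEdge)
  simpleCycle∈simpleCycles (cycle@(_ , _ , refl , _) , distinct)
    with _ , closed ← cycle⇒closedWalk cycle =
    ∈-simpleCycles _ _ closed distinct (λ {e} _ → ∈-allFin e) (λ {e} _ → ∈-allFin (src e)) λ ()

  distinctSimpleCycles-length≤ : ∀ {Cs} → Unique Cs → All (IsSimpleCycle H) Cs →
                                 length Cs ≤ 2 ^ nEdge
  distinctSimpleCycles-length≤ {Cs} distinct simple = begin
    length Cs
      ≤⟨ Unique-⊆⇒length≤ distinct (simpleCycle∈simpleCycles ∘ All.lookup simple) ⟩
    length (simpleCycles (allFin nLoc) (allFin nEdge))
      ≤⟨ length-simpleCycles (allFin nLoc) (allFin nEdge) ⟩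
    2 ^ length (allFin nEdge)
      ≡⟨ cong (2 ^_) (length-tabulate {n = nEdge} id) ⟩
    2 ^ nEdge ∎
    where open ≤-Reasoning

  noRepeatedSimpleCycle⇒length≤ : IsPath H es → NoRepeatedSimpleCycle es →
                                  length es ≤ nLoc * suc (2 ^ nEdge)
  noRepeatedSimpleCycle⇒length≤ {[]}     _    _        = z≤n
  noRepeatedSimpleCycle⇒length≤ {e ∷ es} path noRepeat
    with _ , walk ← nonempty-path⇒walk path
    with Cs , distinct , simple , _ , bound ← cycleBlocks _ (<-wellFounded _) walk noRepeat
    = ≤-trans bound (*-monoʳ-≤ nLoc (s≤s (distinctSimpleCycles-length≤ distinct simple)))

lemma1 : {T : Set} (_⊕_ : T → T → T) (H : LHA) (π ρ : TimedSeq H T) →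
         IsTimedPath H π →
         Star (CntStep H _⊕_) π ρ →
         Irreducible H _⊕_ ρ →
         length ρ ≤ LHA.nLoc H * (2 ^ (LHA.nEdge H + 1) + 1)
lemma1 _⊕_ H π ρ π-path contractions irreducible = begin
  length ρ                     ≡⟨ length-map proj₂ ρ ⟨
  length (edges H ρ)           ≤⟨ noRepeatedSimpleCycle⇒length≤ ρ-path ρ-noRepeat ⟩
  nLoc * suc (2 ^ nEdge)       ≤⟨ *-monoʳ-≤ nLoc (s≤s (^-monoʳ-≤ 2 (m≤m+n nEdge 1))) ⟩
  nLoc * suc (2 ^ (nEdge + 1)) ≡⟨ cong (nLoc *_) (+-comm 1 _) ⟩
  nLoc * (2 ^ (nEdge + 1) + 1) ∎
  where
  open ≤-Reasoning
  open LHA H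
  open Graph H
  ρ-path : IsTimedPath H ρ
  ρ-path = contractions-preserve-path _⊕_ contractions π-path
  ρ-noRepeat : NoRepeatedSimpleCycle (edges H ρ)
  ρ-noRepeat = irreducible⇒noRepeatedSimpleCycle _⊕_ irreducible
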